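{- Let $F=P_{\ell_1}\cup\cdots\cup P_{\ell_k}$ be a linear forest with $k\ge 2$ and $\ell_i\neq 3$ for all $1\le i\le k$. If the graph $P_{2\delta_F+1}\cup P_{\delta_F+1}$ contains no copy of $F$, then $F=2P_\ell$ for some odd $\ell$. Furthermore, in that case $P_{2\delta_F+1}\cup P_{\delta_F+2}$ contains a copy of $F$.
   Context: $P_m$ is the path on $m$ vertices, $\cup$ denotes disjoint union and $2P_\ell=P_\ell\cup P_\ell$. A linear forest $F=P_{\ell_1}\cup\cdots\cup P_{\ell_k}$ is a disjoint union of paths, and $\delta_F=\sum_{i=1}^k\lfloor \ell_i/2\rfloor-1$. -}

module Defs where

open import Data.Nat using (ℕ; zero; suc; _+_; _∸_; _/_)
open import Data.Fin using (Fin; toℕ; splitAt)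
open import Data.List using (List; []; _∷_; map)
open import Data.Nat.ListAction using (sum)
open import Data.Sum using (_⊎_; inj₁; inj₂)
open import Data.Product using (Σ; _×_)
open import Data.Empty using (⊥)
open import Relation.Binary.PropositionalEquality using (_≡_)
open import Function.Definitions using (Injective)

record Graph : Set₁ where
  field
    V : ℕ
    E : Fin V → Fin V → Set
open Graph public

P : ℕ → Graph
P m = record { V = m ; E = λ i j → (toℕ j ≡ suc (toℕ i)) ⊎ (toℕ i ≡ suc (toℕ j)) }

K0 : Graph
K0 = record { V = 0 ; E = λ () }

_∪_ : Graph → Graph → Graph
G ∪ H = record { V = V G + V H ; E = e }
  where
  e : Fin (V G + V H) → Fin (V G + V H) → Set
  e x y with splitAt (V G) x | splitAt (V G) y
  ... | inj₁ a | inj₁ b = E G a b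
  ... | inj₂ a | inj₂ b = E H a b
  ... | _      | _      = ⊥

infixr 5 _∪_

LinearForest : List ℕ → Graph
LinearForest []       = K0
LinearForest (l ∷ ls) = P l ∪ LinearForest ls

_⊆ᵍ_ : Graph → Graph → Set
G ⊆ᵍ H = Σ (Fin (V G) → Fin (V H)) λ f →
           Injective _≡_ _≡_ f × (∀ x y → E G x y → E H (f x) (f y))

-- δ_F = Σ ⌊ℓ_i/2⌋ - 1  (truncated subtraction; under the hypotheses ℓ_i ≥ 2, k ≥ 2 it is ≥ 1).
δ : List ℕ → ℕ
δ ls = sum (map (λ l → l / 2) ls) ∸ 1

-- A sub-forest B of F with t < |B| ≤ σ, where σ = δ_F + 1 = Σ ⌊ℓᵢ/2⌋ and t is the number of odd
-- ℓᵢ, yields a copy of F: B goes on P_{δ+1} and the other |F| − |B| ≤ 2σ + t − (t + 1) = 2δ + 1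
-- vertices on P_{2δ+1}.  Write the lengths as 2a (a ≥ 1) and 2b + 1 (b ≥ 2, as ℓᵢ ≠ 3).  It is
-- enough to find such a B inside a block of paths, with t and σ counted in the block, since even
-- paths outside it add nothing to t.  With at most two odd paths, a block of two or three paths
-- and a single path B work, except when F = 2P_{2b+1}; three or more odd paths, sorted, split into
-- blocks of 3, 4 or 5 whose one or two smallest paths form B.  In the exceptional case
-- δ_F = 2b − 1, and a copy of P_{2b+1} fits on each of P_{4b−1} and P_{2b+1}.

module Submission where

open import Defs
open import Data.Empty using (⊥-elim)
open import Data.Fin using (Fin; toℕ; splitAt; join; _↑ˡ_; _↑ʳ_; fromℕ<)
open import Data.Fin.Properties
  using ( toℕ-↑ˡ; toℕ-↑ʳ; ↑ˡ-injective; ↑ʳ-injective; join-splitAt; splitAt-↑ˡ; splitAt-↑ʳ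
        ; toℕ-fromℕ<; toℕ-injective; toℕ<n)
open import Data.List using (List; []; _∷_; _++_; map; length)
open import Data.List.Properties using (++-assoc; map-++; length-++)
open import Data.List.Relation.Binary.Permutation.Propositional
  using (_↭_; prep; swap; ↭-refl; ↭-trans; ↭-sym; ↭-reflexive; module PermutationReasoning)
import Data.List.Relation.Binary.Permutation.Propositional as Perm
open import Data.List.Relation.Binary.Permutation.Propositional.Properties
  using ( ++⁺; ++⁺ˡ; shift; shifts; ++-comm; map⁺; All-resp-↭; ↭-length
        ; ↭-empty-inv; ↭-singleton-inv; drop-∷; ∈-resp-↭)
open import Data.List.Relation.Unary.All using (All; []; _∷_)
open import Data.List.Relation.Unary.Any using (here; there)
open import Data.List.Relation.Unary.Linked using (_∷_)
open import Data.Nat.Properties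
open import Data.List.Relation.Unary.Sorted.TotalOrder ≤-totalOrder using (Sorted)
open import Data.List.Sort ≤-decTotalOrder using (sort; sort-↭; sort-↗)
open import Data.Nat using (ℕ; zero; suc; _+_; _*_; _∸_; _≤_; _<_; z≤n; s≤s; _/_; _%_)
open import Data.Nat.DivMod using (m*n/n≡m; m/n≡1+[m∸n]/n; [m+kn]%n≡m%n)
open import Data.Nat.ListAction using (sum)
open import Data.Nat.ListAction.Properties using (sum-++; sum-↭)
open import Data.Nat.Tactic.RingSolver using (solve-∀)
open import Data.Product using (Σ; _×_; _,_; ∃-syntax)
open import Data.Sum using (_⊎_; inj₁; inj₂; [_,_]′)
open import Function.Definitions using (Injective)
open import Relation.Binary.Definitions using (tri<; tri≈; tri>)
open import Relation.Binary.PropositionalEquality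
  using (_≡_; _≢_; refl; sym; trans; cong; cong₂; subst; subst₂; module ≡-Reasoning)
open import Relation.Nullary using (¬_; yes; no; contradiction)

-- _⊆ᵍ_ as a record, so that the graphs can be inferred from an embedding.
record _↪_ (G H : Graph) : Set where
  field
    vertex    : Fin (V G) → Fin (V H)
    injective : Injective _≡_ _≡_ vertex
    edge      : ∀ x y → E G x y → E H (vertex x) (vertex y)
open _↪_

infix 4 _↪_

↪⇒⊆ᵍ : ∀ {G H} → G ↪ H → G ⊆ᵍ H
↪⇒⊆ᵍ f = vertex f , injective f , edge f

↪-trans : ∀ {G H K} → G ↪ H → H ↪ K → G ↪ K
↪-trans f g = record
  { vertex = λ x → vertex g (vertex f x)
  ; injective = λ eq → injective f (injective g eq)
  ; edge = λ x y e → edge g _ _ (edge f x y e) }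

record Disjoint {G H K} (f : G ↪ K) (g : H ↪ K) : Set where
  constructor disjoint
  field apart : ∀ a b → vertex f a ≢ vertex g b
open Disjoint

↪-copair : ∀ {G H K} (f : G ↪ K) (g : H ↪ K) → Disjoint f g → G ∪ H ↪ K
↪-copair {G} {H} {K} f g f#g = record { vertex = h ; injective = h-injective ; edge = h-edge }
  where
  h : Fin (V G + V H) → Fin (V K)
  h x = [ vertex f , vertex g ]′ (splitAt (V G) x)
  [f,g]-injective : ∀ (u v : Fin (V G) ⊎ Fin (V H)) →
                    [ vertex f , vertex g ]′ u ≡ [ vertex f , vertex g ]′ v → u ≡ v
  [f,g]-injective (inj₁ a) (inj₁ b) eq = cong inj₁ (injective f eq)
  [f,g]-injective (inj₁ a) (inj₂ b) eq = ⊥-elim (apart f#g a b eq)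
  [f,g]-injective (inj₂ a) (inj₁ b) eq = ⊥-elim (apart f#g b a (sym eq))
  [f,g]-injective (inj₂ a) (inj₂ b) eq = cong inj₂ (injective g eq)
  split-injective : ∀ {x y} → h x ≡ h y → splitAt (V G) x ≡ splitAt (V G) y
  split-injective {x} {y} = [f,g]-injective (splitAt (V G) x) (splitAt (V G) y)
  h-injective : Injective _≡_ _≡_ h
  h-injective {x} {y} eq = begin
    x                                   ≡⟨ join-splitAt (V G) (V H) x ⟨
    join (V G) (V H) (splitAt (V G) x)  ≡⟨ cong (join (V G) (V H)) (split-injective eq) ⟩
    join (V G) (V H) (splitAt (V G) y)  ≡⟨ join-splitAt (V G) (V H) y ⟩
    y                                   ∎
    where open ≡-Reasoning
  h-edge : ∀ x y → E (G ∪ H) x y → E K (h x) (h y)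
  h-edge x y e with splitAt (V G) x | splitAt (V G) y
  ... | inj₁ a | inj₁ b = edge f a b e
  ... | inj₂ a | inj₂ b = edge g a b e

↪-refl : ∀ {G} → G ↪ G
↪-refl = record { vertex = λ x → x ; injective = λ eq → eq ; edge = λ x y e → e }

↪-inl : ∀ {G} H → G ↪ G ∪ H
↪-inl {G} H = record { vertex = _↑ˡ V H ; injective = ↑ˡ-injective (V H) _ _ ; edge = inl-edge }
  where
  inl-edge : ∀ a b → E G a b → E (G ∪ H) (a ↑ˡ V H) (b ↑ˡ V H)
  inl-edge a b e rewrite splitAt-↑ˡ (V G) a (V H) | splitAt-↑ˡ (V G) b (V H) = e

↪-inr : ∀ G {H} → H ↪ G ∪ H
↪-inr G {H} = record { vertex = V G ↑ʳ_ ; injective = ↑ʳ-injective (V G) _ _ ; edge = inr-edge }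
  where
  inr-edge : ∀ a b → E H a b → E (G ∪ H) (V G ↑ʳ a) (V G ↑ʳ b)
  inr-edge a b e rewrite splitAt-↑ʳ (V G) (V H) a | splitAt-↑ʳ (V G) (V H) b = e

inl#inr : ∀ G H → Disjoint (↪-inl {G} H) (↪-inr G)
inl#inr G H = disjoint λ a b eq → <⇒≢ (≤-trans (toℕ<n a) (m≤m+n (V G) (toℕ b)))
  (trans (sym (toℕ-↑ˡ a (V H))) (trans (cong toℕ eq) (toℕ-↑ʳ (V G) b)))

#-sym : ∀ {G H K} {f : G ↪ K} {g : H ↪ K} → Disjoint f g → Disjoint g f
#-sym f#g = disjoint λ a b eq → apart f#g b a (sym eq)

#-precomp : ∀ {G G′ H H′ K} {f : G ↪ K} {g : H ↪ K} (f′ : G′ ↪ G) (g′ : H′ ↪ H) →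
            Disjoint f g → Disjoint (↪-trans f′ f) (↪-trans g′ g)
#-precomp f′ g′ f#g = disjoint λ a b → apart f#g (vertex f′ a) (vertex g′ b)

#-postcomp : ∀ {G H K L} {f : G ↪ K} {g : H ↪ K} (h : K ↪ L) →
             Disjoint f g → Disjoint (↪-trans f h) (↪-trans g h)
#-postcomp h f#g = disjoint λ a b eq → apart f#g a b (injective h eq)

#-copair : ∀ {G H K L} {f : G ↪ L} {g : H ↪ L} {h : K ↪ L} (g#h : Disjoint g h) →
           Disjoint f g → Disjoint f h → Disjoint f (↪-copair g h g#h)
#-copair {H = H} {f = f} {g} {h} g#h f#g f#h = disjoint go
  where
  go : ∀ a x → vertex f a ≢ vertex (↪-copair g h g#h) x
  go a x with splitAt (V H) x
  ... | inj₁ b = apart f#g a b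
  ... | inj₂ b = apart f#h a b

∪-mono : ∀ {G G′ H H′} → G ↪ G′ → H ↪ H′ → G ∪ H ↪ G′ ∪ H′
∪-mono {G′ = G′} {H′ = H′} f g =
  ↪-copair (↪-trans f (↪-inl H′)) (↪-trans g (↪-inr G′)) (#-precomp f g (inl#inr G′ H′))

∪-monoʳ : ∀ G {H H′} → H ↪ H′ → G ∪ H ↪ G ∪ H′
∪-monoʳ G = ∪-mono (↪-refl {G})

∪-assoc : ∀ G H K → G ∪ (H ∪ K) ↪ (G ∪ H) ∪ K
∪-assoc G H K =
  ↪-copair (↪-trans (↪-inl H) (↪-inl K)) (↪-copair (↪-trans (↪-inr G) (↪-inl K)) (↪-inr (G ∪ H)) H#K)
  (#-copair H#K (#-postcomp (↪-inl K) (inl#inr G H)) (#-precomp (↪-inl H) ↪-refl (inl#inr (G ∪ H) K)))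
  where
  H#K = #-precomp (↪-inr G) ↪-refl (inl#inr (G ∪ H) K)

∪-left-comm : ∀ G H K → G ∪ (H ∪ K) ↪ H ∪ (G ∪ K)
∪-left-comm G H K =
  ↪-copair (↪-trans (↪-inl K) (↪-inr H)) (↪-copair (↪-inl (G ∪ K)) (↪-trans (↪-inr G) (↪-inr H)) H#K)
  (#-copair H#K (#-precomp (↪-inl K) ↪-refl (#-sym (inl#inr H (G ∪ K)))) (#-postcomp (↪-inr H) (inl#inr G K)))
  where
  H#K = #-precomp ↪-refl (↪-inr G) (inl#inr H (G ∪ K))

offset : ∀ {a b} c → c + a ≤ b → Fin a → Fin b
offset c c+a≤b j = fromℕ< (≤-trans (+-monoʳ-< c (toℕ<n j)) c+a≤b)

toℕ-offset : ∀ {a b} c (c+a≤b : c + a ≤ b) j → toℕ (offset c c+a≤b j) ≡ c + toℕ j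
toℕ-offset c c+a≤b j = toℕ-fromℕ< _

P-shift : ∀ {a b} c → c + a ≤ b → P a ↪ P b
P-shift {a} {b} c c+a≤b = record { vertex = f ; injective = f-injective ; edge = f-edge }
  where
  f = offset c c+a≤b
  f-injective : Injective _≡_ _≡_ f
  f-injective {i} {j} eq = toℕ-injective (+-cancelˡ-≡ c _ _
    (trans (sym (toℕ-offset c c+a≤b i)) (trans (cong toℕ eq) (toℕ-offset c c+a≤b j))))
  f-succ : ∀ {i j} → toℕ j ≡ suc (toℕ i) → toℕ (f j) ≡ suc (toℕ (f i))
  f-succ {i} {j} eq = begin
    toℕ (f j)          ≡⟨ toℕ-offset c c+a≤b j ⟩
    c + toℕ j          ≡⟨ cong (c +_) eq ⟩
    c + suc (toℕ i)    ≡⟨ +-suc c (toℕ i) ⟩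
    suc (c + toℕ i)    ≡⟨ cong suc (toℕ-offset c c+a≤b i) ⟨
    suc (toℕ (f i))    ∎
    where open ≡-Reasoning
  f-edge : ∀ i j → E (P a) i j → E (P b) (f i) (f j)
  f-edge i j (inj₁ j≡1+i) = inj₁ (f-succ j≡1+i)
  f-edge i j (inj₂ i≡1+j) = inj₂ (f-succ i≡1+j)

P-mono : ∀ {a b} → a ≤ b → P a ↪ P b
P-mono = P-shift 0

P-concat : ∀ a b → P a ∪ P b ↪ P (a + b)
P-concat a b = ↪-copair (P-mono (m≤m+n a b)) (P-shift a ≤-refl) (disjoint λ i j eq →
  <⇒≢ (≤-trans (toℕ<n i) (m≤m+n a (toℕ j)))
      (trans (sym (toℕ-offset 0 (m≤m+n a b) i)) (trans (cong toℕ eq) (toℕ-offset a ≤-refl j))))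

K0↪ : ∀ {G} → K0 ↪ G
K0↪ = record { vertex = λ () ; injective = λ {} ; edge = λ () }

forest↪path : ∀ ls → LinearForest ls ↪ P (sum ls)
forest↪path []       = K0↪
forest↪path (l ∷ ls) = ↪-trans (∪-monoʳ (P l) (forest↪path ls)) (P-concat l (sum ls))

forest-++ : ∀ ls ms → LinearForest (ls ++ ms) ↪ LinearForest ls ∪ LinearForest ms
forest-++ []       ms = ↪-inr K0
forest-++ (l ∷ ls) ms =
  ↪-trans (∪-monoʳ (P l) (forest-++ ls ms)) (∪-assoc (P l) (LinearForest ls) (LinearForest ms))

forest-↭ : ∀ {ls ms} → ls ↭ ms → LinearForest ls ↪ LinearForest ms
forest-↭ Perm.refl          = ↪-refl
forest-↭ (prep l π)         = ∪-monoʳ (P l) (forest-↭ π)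
forest-↭ (swap l m π)       =
  ↪-trans (∪-monoʳ (P l) (∪-monoʳ (P m) (forest-↭ π))) (∪-left-comm (P l) (P m) _)
forest-↭ (Perm.trans π π′) = ↪-trans (forest-↭ π) (forest-↭ π′)

forest↪two-paths : ∀ {ls} A B {x y} → ls ↭ A ++ B → sum A ≤ x → sum B ≤ y →
                   LinearForest ls ↪ P x ∪ P y
forest↪two-paths A B π A≤x B≤y = ↪-trans (forest-↭ π) (↪-trans (forest-++ A B)
  (∪-mono (↪-trans (forest↪path A) (P-mono A≤x)) (↪-trans (forest↪path B) (P-mono B≤y))))

-- The chosen paths are those that go on the shorter path.
record Selection (ls : List ℕ) (lo hi : ℕ) : Set where
  constructor selection
  field
    chosen rest : List ℕ
    split : ls ↭ chosen ++ rest
    lower : lo ≤ sum chosen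
    upper : sum chosen ≤ hi

selection-↭ : ∀ {ls ms lo hi} → ls ↭ ms → Selection ms lo hi → Selection ls lo hi
selection-↭ π (selection c r σ lo≤ ≤hi) = selection c r (↭-trans π σ) lo≤ ≤hi

selection-weaken : ∀ {ls lo lo′ hi hi′} → lo′ ≤ lo → hi ≤ hi′ → Selection ls lo hi → Selection ls lo′ hi′
selection-weaken lo′≤lo hi≤hi′ (selection c r σ lo≤ ≤hi) =
  selection c r σ (≤-trans lo′≤lo lo≤) (≤-trans ≤hi hi≤hi′)

selection-++ : ∀ {ls ms lo lo′ hi hi′} → Selection ls lo hi → Selection ms lo′ hi′ →
               Selection (ls ++ ms) (lo + lo′) (hi + hi′)
selection-++ {ls} {ms} (selection c r σ lo≤ ≤hi) (selection c′ r′ σ′ lo′≤ ≤hi′) =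
  selection (c ++ c′) (r ++ r′) π (≤-trans (+-mono-≤ lo≤ lo′≤) (≤-reflexive (sym (sum-++ c c′))))
                                  (≤-trans (≤-reflexive (sum-++ c c′)) (+-mono-≤ ≤hi ≤hi′))
  where
  open PermutationReasoning
  π : ls ++ ms ↭ (c ++ c′) ++ (r ++ r′)
  π = begin
    ls ++ ms                ↭⟨ ++⁺ σ σ′ ⟩
    (c ++ r) ++ (c′ ++ r′)  ≡⟨ ++-assoc c r (c′ ++ r′) ⟩
    c ++ (r ++ (c′ ++ r′))  ↭⟨ ++⁺ˡ c (shifts r c′) ⟩
    c ++ (c′ ++ (r ++ r′))  ≡⟨ ++-assoc c c′ (r ++ r′) ⟨
    (c ++ c′) ++ (r ++ r′)  ∎

select-none : ∀ ls {hi} → Selection ls 0 hi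
select-none ls = selection [] ls ↭-refl z≤n z≤n

select-head : ∀ {x lo hi} ls → lo ≤ x → x ≤ hi → Selection (x ∷ ls) lo hi
select-head {x} ls lo≤x x≤hi =
  selection (x ∷ []) ls ↭-refl (≤-trans lo≤x (≤-reflexive (sym (+-identityʳ x))))
                                (≤-trans (≤-reflexive (+-identityʳ x)) x≤hi)

select-second : ∀ {x y lo hi} ls → lo ≤ y → y ≤ hi → Selection (x ∷ y ∷ ls) lo hi
select-second {x} {y} ls lo≤y y≤hi = selection-↭ (swap x y ↭-refl) (select-head (x ∷ ls) lo≤y y≤hi)

select-two-heads : ∀ {x y lo hi} ls → lo ≤ x + y → x + y ≤ hi → Selection (x ∷ y ∷ ls) lo hi
select-two-heads {x} {y} ls lo≤ ≤hi =
  selection (x ∷ y ∷ []) ls ↭-refl (≤-trans lo≤ (≤-reflexive (sym x+y+0)))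
                                   (≤-trans (≤-reflexive x+y+0) ≤hi)
  where
  x+y+0 : x + (y + 0) ≡ x + y
  x+y+0 = cong (x +_) (+-identityʳ y)

double : ℕ → ℕ
double n = n * 2

double+1 : ℕ → ℕ
double+1 n = suc (double n)

double≡+ : ∀ n → double n ≡ n + n
double≡+ n = trans (*-suc n 1) (cong (n +_) (*-identityʳ n))

double-mono : ∀ {m n} → m ≤ n → double m ≤ double n
double-mono = *-monoˡ-≤ 2

double+1-mono : ∀ {m n} → m ≤ n → double+1 m ≤ double+1 n
double+1-mono m≤n = s≤s (double-mono m≤n)

double≤+ : ∀ {m n} → m ≤ n → double m ≤ m + n
double≤+ {m} m≤n = ≤-trans (≤-reflexive (double≡+ m)) (+-monoʳ-≤ m m≤n)

double+1≤+ : ∀ {m n} → m < n → double+1 m ≤ m + n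
double+1≤+ {m} m<n =
  ≤-trans (≤-reflexive (trans (cong suc (double≡+ m)) (sym (+-suc m m)))) (+-monoʳ-≤ m m<n)

data Parity : ℕ → Set where
  even : ∀ a → Parity (double a)
  odd  : ∀ b → Parity (double+1 b)

parity : ∀ n → Parity n
parity zero          = even 0
parity (suc zero)    = odd 0
parity (suc (suc n)) with parity n
... | even a = even (suc a)
... | odd b  = odd (suc b)

double/2 : ∀ n → double n / 2 ≡ n
double/2 n = m*n/n≡m n 2

double+1/2 : ∀ n → double+1 n / 2 ≡ n
double+1/2 zero    = refl
double+1/2 (suc n) = trans (m/n≡1+[m∸n]/n {double+1 (suc n)} {2} (s≤s (s≤s z≤n))) (cong suc (double+1/2 n))

double+1%2 : ∀ n → double+1 n % 2 ≡ 1
double+1%2 n = [m+kn]%n≡m%n 1 n 2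

forest : List ℕ → List ℕ → List ℕ
forest as bs = map double as ++ map double+1 bs

split-by-parity : ∀ ls → All (2 ≤_) ls → All (_≢ 3) ls →
                  ∃[ as ] ∃[ bs ] All (1 ≤_) as × All (2 ≤_) bs × ls ↭ forest as bs
split-by-parity [] [] [] = [] , [] , [] , [] , ↭-refl
split-by-parity (l ∷ ls) (2≤l ∷ 2≤ls) (l≢3 ∷ ls≢3) with split-by-parity ls 2≤ls ls≢3 | parity l
... | as , bs , 1≤as , 2≤bs , π | even a =
  a ∷ as , bs , half≥1 a 2≤l ∷ 1≤as , 2≤bs , prep (double a) π
  where
  half≥1 : ∀ a → 2 ≤ double a → 1 ≤ a
  half≥1 zero    ()
  half≥1 (suc a) _ = s≤s z≤n
... | as , bs , 1≤as , 2≤bs , π | odd b =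
  as , b ∷ bs , 1≤as , half≥2 b 2≤l l≢3 ∷ 2≤bs ,
  ↭-trans (prep (double+1 b) π) (↭-sym (shift (double+1 b) (map double as) (map double+1 bs)))
  where
  half≥2 : ∀ b → 2 ≤ double+1 b → double+1 b ≢ 3 → 2 ≤ b
  half≥2 zero          (s≤s ()) _
  half≥2 (suc zero)    _ 3≢3 = contradiction refl 3≢3
  half≥2 (suc (suc b)) _ _   = s≤s (s≤s z≤n)

halves : List ℕ → ℕ
halves ls = sum (map (_/ 2) ls)

sum-map-cancel : ∀ {f g : ℕ → ℕ} → (∀ n → g (f n) ≡ n) → ∀ ns → sum (map g (map f ns)) ≡ sum ns
sum-map-cancel gf []       = refl
sum-map-cancel gf (n ∷ ns) = cong₂ _+_ (gf n) (sum-map-cancel gf ns)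

halves-forest : ∀ as bs → halves (forest as bs) ≡ sum as + sum bs
halves-forest as bs = begin
  sum (map (_/ 2) (map double as ++ map double+1 bs))
    ≡⟨ cong sum (map-++ (_/ 2) (map double as) (map double+1 bs)) ⟩
  sum (map (_/ 2) (map double as) ++ map (_/ 2) (map double+1 bs))
    ≡⟨ sum-++ (map (_/ 2) (map double as)) _ ⟩
  sum (map (_/ 2) (map double as)) + sum (map (_/ 2) (map double+1 bs))
    ≡⟨ cong₂ _+_ (sum-map-cancel double/2 as) (sum-map-cancel double+1/2 bs) ⟩
  sum as + sum bs ∎
  where open ≡-Reasoning

sum-forest : ∀ as bs → sum (forest as bs) ≡ length bs + double (sum as + sum bs)
sum-forest as bs = begin
  sum (map double as ++ map double+1 bs)       ≡⟨ sum-++ (map double as) _ ⟩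
  sum (map double as) + sum (map double+1 bs)  ≡⟨ cong₂ _+_ (sum-doubles as) (sum-double+1s bs) ⟩
  double (sum as) + (length bs + double (sum bs)) ≡⟨ regroup (sum as) (length bs) (sum bs) ⟩
  length bs + double (sum as + sum bs)         ∎
  where
  open ≡-Reasoning
  sum-doubles : ∀ as → sum (map double as) ≡ double (sum as)
  sum-doubles []       = refl
  sum-doubles (a ∷ as) = trans (cong (double a +_) (sum-doubles as)) (sym (*-distribʳ-+ 2 a (sum as)))
  sum-double+1s : ∀ bs → sum (map double+1 bs) ≡ length bs + double (sum bs)
  sum-double+1s []       = refl
  sum-double+1s (b ∷ bs) = trans (cong (double+1 b +_) (sum-double+1s bs)) (step b (length bs) (sum bs))
    where
    step : ∀ b k s → suc (b * 2) + (k + s * 2) ≡ suc (k + (b + s) * 2)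
    step = solve-∀
  regroup : ∀ x k y → x * 2 + (k + y * 2) ≡ k + (x + y) * 2
  regroup = solve-∀

-- The criterion t < |B| ≤ σ, with t = length bs and σ = sum as + sum bs.
Splittable : List ℕ → List ℕ → Set
Splittable as bs = Selection (forest as bs) (suc (length bs)) (sum as + sum bs)

double-pair : ∀ {a₁ a₂} → 1 ≤ a₁ → 1 ≤ a₂ → Splittable (a₁ ∷ a₂ ∷ []) []
double-pair {a₁} {a₂} 1≤a₁ 1≤a₂ rewrite +-identityʳ (a₁ + (a₂ + 0)) | +-identityʳ a₂
  with ≤-total a₁ a₂
... | inj₁ a₁≤a₂ = select-head _ (<⇒≤ (double-mono 1≤a₁)) (double≤+ a₁≤a₂)
... | inj₂ a₂≤a₁ =
  select-second [] (<⇒≤ (double-mono 1≤a₂)) (≤-trans (double≤+ a₂≤a₁) (≤-reflexive (+-comm a₂ a₁)))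

double-odd : ∀ {a b} → 1 ≤ a → 1 ≤ b → Splittable (a ∷ []) (b ∷ [])
double-odd {a} {b} 1≤a 1≤b rewrite +-identityʳ a | +-identityʳ b with a ≤? b
... | yes a≤b = select-head _ (double-mono 1≤a) (double≤+ a≤b)
... | no a≰b  =
  select-second [] (<⇒≤ (double+1-mono 1≤b)) (≤-trans (double+1≤+ (≰⇒> a≰b)) (≤-reflexive (+-comm b a)))

odd-pair : ∀ {b₁ b₂} → 1 ≤ b₁ → 1 ≤ b₂ → b₁ ≢ b₂ → Splittable [] (b₁ ∷ b₂ ∷ [])
odd-pair {b₁} {b₂} 1≤b₁ 1≤b₂ b₁≢b₂ rewrite +-identityʳ b₂ with <-cmp b₁ b₂
... | tri< b₁<b₂ _ _ = select-head _ (double+1-mono 1≤b₁) (double+1≤+ b₁<b₂)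
... | tri≈ _ b₁≡b₂ _ = contradiction b₁≡b₂ b₁≢b₂
... | tri> _ _ b₂<b₁ =
  select-second [] (double+1-mono 1≤b₂) (≤-trans (double+1≤+ b₂<b₁) (≤-reflexive (+-comm b₂ b₁)))

double-odd-odd : ∀ {a b} → 1 ≤ a → 1 ≤ b → Splittable (a ∷ []) (b ∷ b ∷ [])
double-odd-odd {a} {b} 1≤a 1≤b rewrite +-identityʳ a | +-identityʳ b =
  select-second _ (double+1-mono 1≤b) (≤-trans (≤-reflexive (cong suc (double≡+ b))) (+-monoˡ-≤ (b + b) 1≤a))

odd-triple : ∀ {b₁ b₂ b₃} → 2 ≤ b₁ → b₁ ≤ b₂ → 1 ≤ b₃ → Splittable [] (b₁ ∷ b₂ ∷ b₃ ∷ [])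
odd-triple {b₁} {b₂} {b₃} 2≤b₁ b₁≤b₂ 1≤b₃ rewrite +-identityʳ b₃ =
  select-head _ (<⇒≤ (double+1-mono 2≤b₁)) (double+1≤+ (≤-<-trans b₁≤b₂ (m<m+n b₂ 1≤b₃)))

odd-quadruple : ∀ {b₁ b₂ b₃ b₄} → 2 ≤ b₁ → b₁ ≤ b₂ → 1 ≤ b₃ → Splittable [] (b₁ ∷ b₂ ∷ b₃ ∷ b₄ ∷ [])
odd-quadruple {b₁} {b₂} {b₃} {b₄} 2≤b₁ b₁≤b₂ 1≤b₃ rewrite +-identityʳ b₄ =
  select-head _ (double+1-mono 2≤b₁) (double+1≤+ (≤-<-trans b₁≤b₂ (m<m+n b₂ (≤-trans 1≤b₃ (m≤m+n b₃ b₄)))))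

odd-quintuple : ∀ {b₁ b₂ b₃ b₄ b₅} → 1 ≤ b₁ → b₁ ≤ b₂ → b₂ ≤ b₃ → b₁ ≤ b₄ → 2 ≤ b₅ →
                Splittable [] (b₁ ∷ b₂ ∷ b₃ ∷ b₄ ∷ b₅ ∷ [])
odd-quintuple {b₁} {b₂} {b₃} {b₄} {b₅} 1≤b₁ b₁≤b₂ b₂≤b₃ b₁≤b₄ 2≤b₅ rewrite +-identityʳ b₅ =
  select-two-heads _ (+-mono-≤ (double+1-mono 1≤b₁) (double+1-mono (≤-trans 1≤b₁ b₁≤b₂))) upper
  where
  upper : double+1 b₁ + double+1 b₂ ≤ b₁ + (b₂ + (b₃ + (b₄ + b₅)))
  upper = begin
    double+1 b₁ + double+1 b₂     ≡⟨ regroup b₁ b₂ ⟩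
    (b₁ + b₂) + (b₂ + (b₁ + 2))   ≤⟨ +-monoʳ-≤ (b₁ + b₂) (+-mono-≤ b₂≤b₃ (+-mono-≤ b₁≤b₄ 2≤b₅)) ⟩
    (b₁ + b₂) + (b₃ + (b₄ + b₅))  ≡⟨ +-assoc b₁ b₂ _ ⟩
    b₁ + (b₂ + (b₃ + (b₄ + b₅)))  ∎
    where
    open ≤-Reasoning
    regroup : ∀ x y → suc (x * 2) + suc (y * 2) ≡ (x + y) + (y + (x + 2))
    regroup = solve-∀

odds-++ : ∀ bs bs′ → Splittable [] bs → Splittable [] bs′ → Splittable [] (bs ++ bs′)
odds-++ bs bs′ s s′ =
  selection-↭ (↭-reflexive (map-++ double+1 bs bs′))
    (selection-weaken (s≤s (≤-trans (≤-reflexive (length-++ bs)) (+-monoʳ-≤ (length bs) (n≤1+n _))))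
                      (≤-reflexive (sym (sum-++ bs bs′)))
                      (selection-++ s s′))

add-evens : ∀ as bs → Splittable as bs → ∀ as′ → Splittable (as ++ as′) bs
add-evens as bs s as′ =
  selection-↭ π (selection-weaken (m≤m+n _ 0) (≤-reflexive hi≡)
                   (selection-++ s (select-none (map double as′))))
  where
  π : forest (as ++ as′) bs ↭ forest as bs ++ map double as′
  π = begin
    map double (as ++ as′) ++ map double+1 bs                ≡⟨ cong (_++ map double+1 bs) (map-++ double as as′) ⟩
    (map double as ++ map double as′) ++ map double+1 bs     ≡⟨ ++-assoc (map double as) _ _ ⟩
    map double as ++ (map double as′ ++ map double+1 bs)     ↭⟨ ++⁺ˡ (map double as) (++-comm (map double as′) _) ⟩
    map double as ++ (map double+1 bs ++ map double as′)     ≡⟨ ++-assoc (map double as) _ _ ⟨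
    (map double as ++ map double+1 bs) ++ map double as′     ∎
    where open PermutationReasoning
  hi≡ : (sum as + sum bs) + sum as′ ≡ sum (as ++ as′) + sum bs
  hi≡ = trans (regroup (sum as) (sum bs) (sum as′)) (cong (_+ sum bs) (sym (sum-++ as as′)))
    where
    regroup : ∀ x y z → (x + y) + z ≡ (x + z) + y
    regroup = solve-∀

sorted-odds : ∀ bs → Sorted bs → All (2 ≤_) bs → 3 ≤ length bs → Splittable [] bs
sorted-odds (b₁ ∷ b₂ ∷ b₃ ∷ []) (b₁≤b₂ ∷ _) (2≤b₁ ∷ _ ∷ 2≤b₃ ∷ []) _ =
  odd-triple 2≤b₁ b₁≤b₂ (<⇒≤ 2≤b₃)
sorted-odds (b₁ ∷ b₂ ∷ b₃ ∷ b₄ ∷ []) (b₁≤b₂ ∷ _) (2≤b₁ ∷ _ ∷ 2≤b₃ ∷ _) _ =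
  odd-quadruple 2≤b₁ b₁≤b₂ (<⇒≤ 2≤b₃)
sorted-odds (b₁ ∷ b₂ ∷ b₃ ∷ b₄ ∷ b₅ ∷ []) (b₁≤b₂ ∷ b₂≤b₃ ∷ b₃≤b₄ ∷ _) (2≤b₁ ∷ _ ∷ _ ∷ _ ∷ 2≤b₅ ∷ []) _
  =
  odd-quintuple (<⇒≤ 2≤b₁) b₁≤b₂ b₂≤b₃ (≤-trans b₁≤b₂ (≤-trans b₂≤b₃ b₃≤b₄)) 2≤b₅
sorted-odds (b₁ ∷ b₂ ∷ b₃ ∷ bs@(_ ∷ _ ∷ _ ∷ _)) (b₁≤b₂ ∷ _ ∷ _ ∷ sorted) (2≤b₁ ∷ _ ∷ 2≤b₃ ∷ 2≤bs) _
  =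
  odds-++ (b₁ ∷ b₂ ∷ b₃ ∷ []) bs (odd-triple 2≤b₁ b₁≤b₂ (<⇒≤ 2≤b₃))
          (sorted-odds bs sorted 2≤bs (s≤s (s≤s (s≤s z≤n))))
sorted-odds []            _ _ ()
sorted-odds (_ ∷ [])      _ _ (s≤s ())
sorted-odds (_ ∷ _ ∷ [])  _ _ (s≤s (s≤s ()))

odds : ∀ bs → All (2 ≤_) bs → 3 ≤ length bs → Splittable [] bs
odds bs 2≤bs 3≤len =
  selection-↭ (map⁺ double+1 (↭-sym (sort-↭ bs)))
    (subst₂ (Selection (map double+1 (sort bs))) (cong suc (↭-length (sort-↭ bs))) (sum-↭ (sort-↭ bs))
      (sorted-odds (sort bs) (sort-↗ bs) (All-resp-↭ (↭-sym (sort-↭ bs)) 2≤bs)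
                   (subst (3 ≤_) (sym (↭-length (sort-↭ bs))) 3≤len)))

splittable-or-twin : ∀ as bs → All (1 ≤_) as → All (2 ≤_) bs → 2 ≤ length (forest as bs) →
                     Splittable as bs ⊎ (as ≡ [] × ∃[ b ] bs ≡ b ∷ b ∷ [])
splittable-or-twin (a₁ ∷ a₂ ∷ as) [] (1≤a₁ ∷ 1≤a₂ ∷ _) _ _ =
  inj₁ (add-evens (a₁ ∷ a₂ ∷ []) [] (double-pair 1≤a₁ 1≤a₂) as)
splittable-or-twin (a ∷ as) (b ∷ []) (1≤a ∷ _) (2≤b ∷ []) _ =
  inj₁ (add-evens (a ∷ []) (b ∷ []) (double-odd 1≤a (<⇒≤ 2≤b)) as)
splittable-or-twin as (b₁ ∷ b₂ ∷ []) 1≤as (2≤b₁ ∷ 2≤b₂ ∷ []) _ with b₁ ≟ b₂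
... | no b₁≢b₂ = inj₁ (add-evens [] (b₁ ∷ b₂ ∷ []) (odd-pair (<⇒≤ 2≤b₁) (<⇒≤ 2≤b₂) b₁≢b₂) as)
splittable-or-twin [] (b ∷ b ∷ []) _ _ _ | yes refl = inj₂ (refl , b , refl)
splittable-or-twin (a ∷ as) (b ∷ b ∷ []) (1≤a ∷ _) (2≤b ∷ _) _ | yes refl =
  inj₁ (add-evens (a ∷ []) (b ∷ b ∷ []) (double-odd-odd 1≤a (<⇒≤ 2≤b)) as)
splittable-or-twin as bs@(_ ∷ _ ∷ _ ∷ _) _ 2≤bs _ =
  inj₁ (add-evens [] bs (odds bs 2≤bs (s≤s (s≤s (s≤s z≤n)))) as)
splittable-or-twin [] [] _ _ ()
splittable-or-twin (_ ∷ []) [] _ _ (s≤s ())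
splittable-or-twin [] (_ ∷ []) _ _ (s≤s ())

two-bins : ∀ {c r t σ} → c + r ≡ t + double σ → suc t ≤ c → c ≤ σ →
           r ≤ 2 * (σ ∸ 1) + 1 × c ≤ σ ∸ 1 + 1
two-bins {σ = zero}  _ t<c c≤0 = contradiction (≤-trans t<c c≤0) λ ()
two-bins {c} {r} {t} {suc s} c+r≡ t<c c≤σ =
  +-cancelʳ-≤ (suc t) r (2 * s + 1) r+t<total , ≤-trans c≤σ (≤-reflexive (+-comm 1 s))
  where
  r+t<total : r + suc t ≤ (2 * s + 1) + suc t
  r+t<total = begin
    r + suc t                 ≤⟨ +-monoʳ-≤ r t<c ⟩
    r + c                     ≡⟨ +-comm r c ⟩
    c + r                     ≡⟨ c+r≡ ⟩
    t + double (suc s)        ≡⟨ regroup t s ⟩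
    (2 * s + 1) + suc t       ∎
    where
    open ≤-Reasoning
    regroup : ∀ t s → t + suc s * 2 ≡ (2 * s + 1) + suc t
    regroup = solve-∀

selection⇒embedding : ∀ {ls t} → Selection ls (suc t) (halves ls) → sum ls ≡ t + double (halves ls) →
                      LinearForest ls ↪ P (2 * δ ls + 1) ∪ P (δ ls + 1)
selection⇒embedding (selection c r π t<c c≤σ) total
  with two-bins (trans (sym (trans (sum-↭ π) (sum-++ c r))) total) t<c c≤σ
... | r-fits , c-fits = forest↪two-paths r c (↭-trans π (++-comm c r)) r-fits c-fits

splittable⇒embedding : ∀ {ls} as bs → ls ↭ forest as bs → Splittable as bs →
                       LinearForest ls ↪ P (2 * δ ls + 1) ∪ P (δ ls + 1)
splittable⇒embedding {ls} as bs π s =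
  selection⇒embedding (selection-weaken ≤-refl (≤-reflexive (sym halves≡)) (selection-↭ π s)) total
  where
  halves≡ : halves ls ≡ sum as + sum bs
  halves≡ = trans (sum-↭ (map⁺ (_/ 2) π)) (halves-forest as bs)
  total : sum ls ≡ length bs + double (halves ls)
  total = trans (sum-↭ π) (trans (sum-forest as bs) (cong (λ σ → length bs + double σ) (sym halves≡)))

↭-pair-inv : ∀ {x : ℕ} {ls} → ls ↭ x ∷ x ∷ [] → ls ≡ x ∷ x ∷ []
↭-pair-inv {ls = []} π with () ← ↭-empty-inv (↭-sym π)
↭-pair-inv {x} {y ∷ ys} π with ∈-resp-↭ π (here refl)
... | here refl         = cong (x ∷_) (↭-singleton-inv (drop-∷ π))
... | there (here refl) = cong (x ∷_) (↭-singleton-inv (drop-∷ π))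

twin-embedding : ∀ b → let F = double+1 b ∷ double+1 b ∷ [] in
                 LinearForest F ↪ P (2 * δ F + 1) ∪ P (δ F + 2)
twin-embedding zero = forest↪two-paths (1 ∷ []) (1 ∷ []) ↭-refl ≤-refl (s≤s z≤n)
twin-embedding (suc c) rewrite double+1/2 (suc c) =
  forest↪two-paths (double+1 (suc c) ∷ []) (double+1 (suc c) ∷ []) ↭-refl
    (≤-trans (m≤n+m _ (c * 2)) (≤-reflexive (long c))) (≤-reflexive (short c))
  where
  long : ∀ c → c * 2 + (suc (suc c * 2) + 0) ≡ 2 * (c + (suc c + 0)) + 1
  long = solve-∀
  short : ∀ c → suc (suc c * 2) + 0 ≡ c + (suc c + 0) + 2
  short = solve-∀

lemma7 : (ls : List ℕ) → 2 ≤ length ls → All (λ l → 2 ≤ l) ls → All (λ l → l ≢ 3) ls →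
    ¬ (LinearForest ls ⊆ᵍ (P (2 * δ ls + 1) ∪ P (δ ls + 1))) →
    Σ ℕ (λ l → (l % 2 ≡ 1) × (ls ≡ l ∷ l ∷ []))
      × (LinearForest ls ⊆ᵍ (P (2 * δ ls + 1) ∪ P (δ ls + 2)))
lemma7 ls 2≤k 2≤ℓ ℓ≢3 F⊈ with split-by-parity ls 2≤ℓ ℓ≢3
... | as , bs , 1≤as , 2≤bs , π
    with splittable-or-twin as bs 1≤as 2≤bs (subst (2 ≤_) (↭-length π) 2≤k)
...   | inj₁ s = ⊥-elim (F⊈ (↪⇒⊆ᵍ (splittable⇒embedding as bs π s)))
...   | inj₂ (refl , b , refl) with refl ← ↭-pair-inv π =
  (double+1 b , double+1%2 b , refl) , ↪⇒⊆ᵍ (twin-embedding b)
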